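{- For all integers $q,p,x,y$, writing $B=B(q,p,x)$, $C=C(q,p,x,y)$, $F=F(q,p,x,y)$, $H=H(q,p,x,y)$, the following congruences hold: \begin{itemize} \item[(1)] $C \equiv p^3 \pmod{q^2}$; \item[(2)] $F \equiv p^4 \pmod{q^2}$; \item[(3)] $H \equiv p^6 \pmod{q^2}$; \item[(4)] $H \equiv -8C^2 \pmod{9|F|}$; \item[(5)] $p^4 - 2pC + F \equiv 0 \pmod{q^3}$; \item[(6)] $4p^6 - 5p^3 C + H \equiv 0 \pmod{q^3}$. \end{itemize}
   Context: The polynomials $B,C,F,H$ with integer coefficients are defined by $B(q,p,x) = p^2 - q^2x$, $C(q,p,x,y) = p^3 - 3pq^2x + 2q^3y$, $F(q,p,x,y) = 4pC - 3B^2$, and $H(q,p,x,y) = 9FB - 8C^2$ (where in the last two, $B$ and $C$ denote $B(q,p,x)$ and $C(q,p,x,y)$). For integers $a,b,m$, $a \equiv b \pmod m$ means that $m$ divides $a-b$ (so modulo $0$ it means $a=b$). -}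

module Defs where

open import Data.Integer using (ℤ; +_; _+_; _-_; _*_; -_; ∣_∣)
open import Data.Integer.Divisibility using (_∣_)

-- a ≡ b (mod m)  means  m ∣ (a - b)  (for m = 0 this means a = b)
_≡_[mod_] : ℤ → ℤ → ℤ → Set
a ≡ b [mod m ] = m ∣ (a - b)

infix 4 _≡_[mod_]

B : ℤ → ℤ → ℤ → ℤ
B q p x = p * p - q * q * x

C : ℤ → ℤ → ℤ → ℤ → ℤ
C q p x y = p * p * p - + 3 * p * (q * q) * x + + 2 * (q * q * q) * y

F : ℤ → ℤ → ℤ → ℤ → ℤ
F q p x y = + 4 * p * C q p x y - + 3 * (B q p x * B q p x)

H : ℤ → ℤ → ℤ → ℤ → ℤ
H q p x y = + 9 * F q p x y * B q p x - + 8 * (C q p x y * C q p x y)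

{-# OPTIONS --safe #-}
module Submission where

-- Modulo q² the parameters x and y disappear: C ≡ p³ and B ≡ p². Writing F − p⁴ and
-- H − p⁶ as combinations of C − p³, B − p² and F − p⁴ then gives F ≡ 4p⁴ − 3p⁴ = p⁴
-- and H ≡ 9p⁶ − 8p⁶ = p⁶. Congruence (4) is the identity H + 8C² = 9FB, and (5), (6)
-- exhibit the left-hand side as an explicit multiple of q³.

open import Defs
open import Data.Integer using (ℤ; +_; _+_; _-_; _*_; -_; ∣_∣; _^_)
open import Data.Integer.Divisibility.Signed
  using (_∣_; divides; ∣⇒∣ᵤ; ∣m∣∣m; ∣m∣n⇒∣m+n; ∣m∣n⇒∣m-n; ∣n⇒∣m*n; ∣m⇒∣m*n; *-monoʳ-∣)
open import Data.Integer.Solver using (module +-*-Solver)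
open import Data.Product using (_×_; _,_)
open import Relation.Binary.PropositionalEquality using (_≡_; refl; sym; subst)

open +-*-Solver using (Polynomial; solve; _:=_; con; _:+_; _:-_; _:*_; _:^_; :-_)

m∣4pc-3b²-p⁴ : ∀ {m} p b c → m ∣ c - p ^ 3 → m ∣ b - p ^ 2 →
             m ∣ (+ 4 * p * c - + 3 * (b * b)) - p ^ 4
m∣4pc-3b²-p⁴ {m} p b c m∣c-p³ m∣b-p² =
  subst (m ∣_) (sym factorisation)
    (∣m∣n⇒∣m-n (∣n⇒∣m*n (+ 4 * p) m∣c-p³) (∣n⇒∣m*n (+ 3) (∣m⇒∣m*n (b + p ^ 2) m∣b-p²)))
  where
  factorisation : (+ 4 * p * c - + 3 * (b * b)) - p ^ 4
                  ≡ + 4 * p * (c - p ^ 3) - + 3 * ((b - p ^ 2) * (b + p ^ 2))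
  factorisation = solve 3 (λ p b c →
    (con (+ 4) :* p :* c :- con (+ 3) :* (b :* b)) :- p :^ 4
    := con (+ 4) :* p :* (c :- p :^ 3) :- con (+ 3) :* ((b :- p :^ 2) :* (b :+ p :^ 2))) refl p b c

m∣9fb-8c²-p⁶ : ∀ {m} p b c f → m ∣ f - p ^ 4 → m ∣ b - p ^ 2 → m ∣ c - p ^ 3 →
             m ∣ (+ 9 * f * b - + 8 * (c * c)) - p ^ 6
m∣9fb-8c²-p⁶ {m} p b c f m∣f-p⁴ m∣b-p² m∣c-p³ =
  subst (m ∣_) (sym factorisation)
    (∣m∣n⇒∣m-n (∣m∣n⇒∣m+n (∣n⇒∣m*n (+ 9 * b) m∣f-p⁴) (∣n⇒∣m*n (+ 9 * p ^ 4) m∣b-p²))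
               (∣n⇒∣m*n (+ 8) (∣m⇒∣m*n (c + p ^ 3) m∣c-p³)))
  where
  factorisation : (+ 9 * f * b - + 8 * (c * c)) - p ^ 6
                  ≡ + 9 * b * (f - p ^ 4) + + 9 * p ^ 4 * (b - p ^ 2)
                    - + 8 * ((c - p ^ 3) * (c + p ^ 3))
  factorisation = solve 4 (λ p b c f →
    (con (+ 9) :* f :* b :- con (+ 8) :* (c :* c)) :- p :^ 6
    := con (+ 9) :* b :* (f :- p :^ 4) :+ con (+ 9) :* p :^ 4 :* (b :- p :^ 2)
       :- con (+ 8) :* ((c :- p :^ 3) :* (c :+ p :^ 3))) refl p b c f

9∣f∣∣9fb-8c²+8c² : ∀ f b c → + 9 * + ∣ f ∣ ∣ (+ 9 * f * b - + 8 * (c * c)) - - (+ 8 * c ^ 2)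
9∣f∣∣9fb-8c²+8c² f b c =
  subst (_ ∣_) (sym cancel) (∣m⇒∣m*n b (*-monoʳ-∣ (+ 9) (∣m∣∣m {f})))
  where
  cancel : (+ 9 * f * b - + 8 * (c * c)) - - (+ 8 * c ^ 2) ≡ + 9 * f * b
  cancel = solve 3 (λ f b c →
    (con (+ 9) :* f :* b :- con (+ 8) :* (c :* c)) :- :- (con (+ 8) :* c :^ 2)
    := con (+ 9) :* f :* b) refl f b c

-- Copies of B, C, F, H as solver expressions: their denotations are definitionally
-- B, C, F, H, so identities proved by `solve` can be stated in terms of the originals.
B̂ : ∀ {n} → Polynomial n → Polynomial n → Polynomial n → Polynomial n
B̂ q p x = p :* p :- q :* q :* x

Ĉ : ∀ {n} → Polynomial n → Polynomial n → Polynomial n → Polynomial n → Polynomial n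
Ĉ q p x y = p :* p :* p :- con (+ 3) :* p :* (q :* q) :* x :+ con (+ 2) :* (q :* q :* q) :* y

F̂ : ∀ {n} → Polynomial n → Polynomial n → Polynomial n → Polynomial n → Polynomial n
F̂ q p x y = con (+ 4) :* p :* Ĉ q p x y :- con (+ 3) :* (B̂ q p x :* B̂ q p x)

Ĥ : ∀ {n} → Polynomial n → Polynomial n → Polynomial n → Polynomial n → Polynomial n
Ĥ q p x y = con (+ 9) :* F̂ q p x y :* B̂ q p x :- con (+ 8) :* (Ĉ q p x y :* Ĉ q p x y)

q²∣B-p² : ∀ q p x → q ^ 2 ∣ B q p x - p ^ 2
q²∣B-p² q p x = divides (- x) expansion
  where
  expansion : B q p x - p ^ 2 ≡ - x * q ^ 2
  expansion = solve 3 (λ q p x → B̂ q p x :- p :^ 2 := :- x :* q :^ 2) refl q p x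

q²∣C-p³ : ∀ q p x y → q ^ 2 ∣ C q p x y - p ^ 3
q²∣C-p³ q p x y = divides quotient expansion
  where
  quotient : ℤ
  quotient = + 2 * q * y - + 3 * p * x
  expansion : C q p x y - p ^ 3 ≡ quotient * q ^ 2
  expansion = solve 4 (λ q p x y →
    Ĉ q p x y :- p :^ 3 := (con (+ 2) :* q :* y :- con (+ 3) :* p :* x) :* q :^ 2) refl q p x y

q³∣p⁴-2pC+F : ∀ q p x y → q ^ 3 ∣ p ^ 4 - + 2 * p * C q p x y + F q p x y - + 0
q³∣p⁴-2pC+F q p x y = divides quotient expansion
  where
  quotient : ℤ
  quotient = + 4 * p * y - + 3 * q * x ^ 2
  expansion : p ^ 4 - + 2 * p * C q p x y + F q p x y - + 0 ≡ quotient * q ^ 3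
  expansion = solve 4 (λ q p x y →
    p :^ 4 :- con (+ 2) :* p :* Ĉ q p x y :+ F̂ q p x y :- con (+ 0)
    := (con (+ 4) :* p :* y :- con (+ 3) :* q :* x :^ 2) :* q :^ 3) refl q p x y

q³∣4p⁶-5p³C+H : ∀ q p x y → q ^ 3 ∣ + 4 * p ^ 6 - + 5 * p ^ 3 * C q p x y + H q p x y - + 0
q³∣4p⁶-5p³C+H q p x y = divides quotient expansion
  where
  quotient : ℤ
  quotient = + 30 * p ^ 3 * y - + 45 * p ^ 2 * q * x ^ 2 + + 24 * p * q ^ 2 * x * y
             + + 27 * q ^ 3 * x ^ 3 - + 32 * q ^ 3 * y ^ 2
  expansion : + 4 * p ^ 6 - + 5 * p ^ 3 * C q p x y + H q p x y - + 0 ≡ quotient * q ^ 3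
  expansion = solve 4 (λ q p x y →
    con (+ 4) :* p :^ 6 :- con (+ 5) :* p :^ 3 :* Ĉ q p x y :+ Ĥ q p x y :- con (+ 0)
    := (con (+ 30) :* p :^ 3 :* y :- con (+ 45) :* p :^ 2 :* q :* x :^ 2
        :+ con (+ 24) :* p :* q :^ 2 :* x :* y :+ con (+ 27) :* q :^ 3 :* x :^ 3
        :- con (+ 32) :* q :^ 3 :* y :^ 2) :* q :^ 3) refl q p x y

theorem2p3 : (q p x y : ℤ) →
    (C q p x y ≡ p ^ 3 [mod q ^ 2 ])
    × (F q p x y ≡ p ^ 4 [mod q ^ 2 ])
    × (H q p x y ≡ p ^ 6 [mod q ^ 2 ])
    × (H q p x y ≡ - (+ 8 * (C q p x y ^ 2)) [mod + 9 * + ∣ F q p x y ∣ ])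
    × (p ^ 4 - + 2 * p * C q p x y + F q p x y ≡ + 0 [mod q ^ 3 ])
    × (+ 4 * p ^ 6 - + 5 * p ^ 3 * C q p x y + H q p x y ≡ + 0 [mod q ^ 3 ])
theorem2p3 q p x y =
    ∣⇒∣ᵤ C≡p³
  , ∣⇒∣ᵤ F≡p⁴
  , ∣⇒∣ᵤ (m∣9fb-8c²-p⁶ p b c f F≡p⁴ B≡p² C≡p³)
  , ∣⇒∣ᵤ (9∣f∣∣9fb-8c²+8c² f b c)
  , ∣⇒∣ᵤ (q³∣p⁴-2pC+F q p x y)
  , ∣⇒∣ᵤ (q³∣4p⁶-5p³C+H q p x y)
  where
  b c f : ℤ
  b = B q p x
  c = C q p x y
  f = F q p x y
  B≡p² : q ^ 2 ∣ b - p ^ 2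
  B≡p² = q²∣B-p² q p x
  C≡p³ : q ^ 2 ∣ c - p ^ 3
  C≡p³ = q²∣C-p³ q p x y
  F≡p⁴ : q ^ 2 ∣ f - p ^ 4
  F≡p⁴ = m∣4pc-3b²-p⁴ p b c C≡p³ B≡p²
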